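{- Let $(G,+)$ and $(H,\oplus)$ be finite groups, $f:G\to H$, and $m\in\mathbb{N}$ even with $2^m\le|G|^{1/4}$. Consider the Unpredictable Random Signs Test with parameter $m$, and let $\mathcal{D}^X$ denote the distribution of its last query $y$ conditioned on the initial queries $X=(x_1,\dots,x_m)$. Then, with probability at least $1-1/2^m$ over the choice of $X$, the distribution $\mathcal{D}^X$ is $1/\binom{m}{m/2}$-flat.
   Context: Unpredictable Random Signs Test with parameter $m$: draw $x_1,\dots,x_m\in G$ independently and uniformly and query $f(x_1),\dots,f(x_m)$; draw signs $\sigma_1,\dots,\sigma_m\in\{+,-\}$ independently and uniformly; let $S$ be a uniformly random subset of $[m]$ of size $m/2$; query $f(y)$ where $y=\sum_{j\in S}\sigma_j x_j$ (increasing index order, $+b=b$, $-b$ the inverse of $b$); accept iff $\bigoplus_{j\in S}\sigma_jf(x_j)=f(y)$. A distribution on $G$ is $\alpha$-flat if every element has probability at most $\alpha$. -}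

module Defs where

open import Level using (_⊔_)
open import Algebra.Bundles using (Group)
open import Data.Nat using (ℕ; zero; suc; _*_; _^_; _≤_; _/_)
open import Data.Nat.Properties using (_≤?_)
import Data.Nat.Properties as ℕP
open import Data.Nat.Combinatorics using (_C_)
open import Data.Fin using (Fin)
open import Data.Bool using (Bool; true; false; if_then_else_)
open import Data.Vec using (Vec; []; _∷_)
open import Data.List using (List; []; _∷_; map; concatMap; filter; length; allFin; cartesianProduct)
open import Data.List.Relation.Unary.All using (All; all?)
open import Data.Fin.Subset using (Subset; ∣_∣)
open import Data.Product using (Σ; _×_; _,_; proj₁; proj₂)
open import Relation.Binary using (Decidable)
open import Relation.Binary.PropositionalEquality using (_≡_)
open import Relation.Nullary using (Dec)

record IsFiniteGroup {c ℓ} (G : Group c ℓ) : Set (c ⊔ ℓ) where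
  open Group G
  field
    card      : ℕ
    enum      : Fin card → Carrier
    enum-inj  : ∀ i j → enum i ≈ enum j → i ≡ j
    enum-surj : ∀ x → Σ (Fin card) (λ i → enum i ≈ x)
    _≈?_      : Decidable _≈_

  elements : List Carrier
  elements = map enum (allFin card)

allVecs : ∀ {a} {A : Set a} (m : ℕ) → List A → List (Vec A m)
allVecs zero    xs = [] ∷ []
allVecs (suc m) xs = concatMap (λ a → map (a ∷_) (allVecs m xs)) xs

-- sign vectors: true = '+', false = '-'
allSigns : (m : ℕ) → List (Vec Bool m)
allSigns m = allVecs m (true ∷ false ∷ [])

halfSubsets : (m : ℕ) → List (Subset m)
halfSubsets m = filter (λ S → ∣ S ∣ ℕP.≟ (m / 2)) (allVecs m (true ∷ false ∷ []))

module URST {c ℓ} (G : Group c ℓ) (FG : IsFiniteGroup G) where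
  open Group G
  open IsFiniteGroup FG

  -- y = Σ_{j∈S} σ_j x_j, summed in increasing index order starting from ε
  sumFrom : Carrier → ∀ {m} → Vec Carrier m → Vec Bool m → Subset m → Carrier
  sumFrom acc []       []       []       = acc
  sumFrom acc (x ∷ xs) (s ∷ ss) (b ∷ bs) =
    sumFrom (if b then acc ∙ (if s then x else x ⁻¹) else acc) xs ss bs

  lastQuery : ∀ {m} → Vec Carrier m → Vec Bool m → Subset m → Carrier
  lastQuery = sumFrom ε

  -- sample space of the test's randomness after X is fixed: (σ, S), uniform
  randomness : (m : ℕ) → List (Vec Bool m × Subset m)
  randomness m = cartesianProduct (allSigns m) (halfSubsets m)

  -- number of outcomes (σ, S) with y = z; D^X(z) = hits X z / length (randomness m)
  hits : ∀ {m} → Vec Carrier m → Carrier → ℕ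
  hits {m} X z = length (filter (λ p → lastQuery X (proj₁ p) (proj₂ p) ≈? z) (randomness m))

  -- D^X is 1/(m choose m/2)-flat:
  --   ∀ z, hits X z / |randomness| ≤ 1 / (m C (m/2)), cross-multiplied
  FlatDX : ∀ {m} → Vec Carrier m → Set c
  FlatDX {m} X = All (λ z → hits X z * (m C (m / 2)) ≤ length (randomness m)) elements

  flatDX? : ∀ {m} (X : Vec Carrier m) → Dec (FlatDX X)
  flatDX? {m} X = all? (λ z → hits X z * (m C (m / 2)) ≤? length (randomness m)) elements

  allX : (m : ℕ) → List (Vec Carrier m)
  allX m = allVecs m elements

  numX : ℕ → ℕ
  numX m = length (allX m)

  numGoodX : ℕ → ℕ
  numGoodX m = length (filter flatDX? (allX m))

module Submission where

-- Call X collision-free when no sign vector σ and distinct half-size subsets S ≠ S′ give the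
-- same last query.  For collision-free X and each σ at most one S hits a given z, so
-- D^X(z) ≤ 2^m / (2^m · C(m, m/2)).  For fixed (σ, S, S′) pick j ∈ S ∖ S′: the collision
-- equation determines x_j from the other coordinates, so at most |G|^(m-1) of the |G|^m
-- tuples X collide, and a union bound over at most 2^(3m) triples gives
-- Pr[X not collision-free] ≤ 2^(3m) / |G| ≤ 2^(-m).

open import Defs
open import Level using (Level)
open import Algebra.Bundles using (Group)
open import Data.Nat using (ℕ; _+_; _*_; _^_; _≤_)
open import Data.Nat.Divisibility using (_∣_)

open import Level using (_⊔_)
open import Data.Nat using (zero; suc; z≤n; s≤s; _/_)
open import Data.Nat.Properties
  using (≤-reflexive; ≤-trans; <⇒≤; <-irrefl; +-assoc; +-identityʳ; +-mono-≤; +-monoʳ-≤; *-identityʳ; *-zeroʳ;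
         *-mono-≤; *-monoˡ-≤; *-distribʳ-+; m≤n+m; +-commutativeSemigroup; module ≤-Reasoning)
import Data.Nat.Properties as ℕ
open import Data.Nat.Combinatorics using (_C_; nCk+nC[k+1]≡[n+1]C[k+1])
open import Data.Nat.Tactic.RingSolver using (solve-∀)
open import Algebra.Properties.CommutativeSemigroup +-commutativeSemigroup using (interchange)
import Algebra.Properties.Group as GroupProperties
open import Data.Bool using (Bool; true; false; if_then_else_)
import Data.Bool.Properties as Bool
open import Data.Fin using (Fin; zero; suc)
open import Data.Fin.Subset using (Subset; inside; outside; ∣_∣; _∈_; _∉_)
open import Data.Fin.Subset.Properties using (drop-there)
open import Data.Vec using (Vec; []; _∷_; insertAt)
open import Data.Vec.Base using (here; there)
import Data.Vec.Properties as Vec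
open import Data.Vec.Relation.Binary.Pointwise.Inductive as Pointwise using (Pointwise; ≡⇒Pointwise-≡)
open import Data.List using (List; []; _∷_; _++_; map; concatMap; filter; length; allFin; cartesianProduct)
open import Data.List.Properties using (length-map; length-tabulate)
import Data.List.Properties as List
open import Data.List.Relation.Unary.Any as Any using (Any; here; there; satisfied)
open import Data.List.Relation.Unary.All as All using (All; []; _∷_)
open import Data.List.Relation.Unary.All.Properties.Core using (¬Any⇒All¬)
open import Data.List.Relation.Unary.AllPairs using ([]; _∷_)
open import Data.List.Relation.Unary.Unique.Propositional using (Unique)
open import Data.List.Relation.Unary.Unique.Propositional.Properties using (allFin⁺)
open import Data.List.Membership.Propositional using () renaming (_∈_ to _∈ˡ_)
open import Data.List.Membership.Propositional.Properties
  using (∈-map⁺; ∈-concat⁺′; ∈-filter⁺; ∈-filter⁻; ∈-cartesianProduct⁺; ∈-cartesianProduct⁻)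
open import Data.Product using (∃; _×_; _,_; proj₁; proj₂)
open import Data.Empty using (⊥-elim)
open import Function using (_∘_)
open import Relation.Binary using (Rel)
open import Relation.Binary.PropositionalEquality
  using (_≡_; _≢_; refl; sym; trans; cong; cong₂; subst; module ≡-Reasoning)
open import Relation.Nullary using (Dec; yes; no; does; ¬_; ¬?)
open import Relation.Unary using (Pred; Decidable)
open import Relation.Unary.Properties using (∁?; _∩?_)

private variable
  a b p q ℓ : Level
  A : Set a
  B : Set b

-- Sums and counts over lists

∑ : List A → (A → ℕ) → ℕ
∑ []       f = 0
∑ (x ∷ xs) f = f x + ∑ xs f

infix 5 ∑
syntax ∑ xs (λ x → e) = ∑[ x ← xs ] e

𝟙 : {P : Set p} → Dec P → ℕ
𝟙 d = if does d then 1 else 0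

count : {P : Pred A p} → Decidable P → List A → ℕ
count P? xs = ∑[ x ← xs ] 𝟙 (P? x)

∑-cong : ∀ (xs : List A) {f g : A → ℕ} → (∀ x → f x ≡ g x) → ∑ xs f ≡ ∑ xs g
∑-cong []       f≡g = refl
∑-cong (x ∷ xs) f≡g = cong₂ _+_ (f≡g x) (∑-cong xs f≡g)

∑-mono-∈ : ∀ (xs : List A) {f g : A → ℕ} → (∀ {x} → x ∈ˡ xs → f x ≤ g x) → ∑ xs f ≤ ∑ xs g
∑-mono-∈ []       f≤g = z≤n
∑-mono-∈ (x ∷ xs) f≤g = +-mono-≤ (f≤g (here refl)) (∑-mono-∈ xs (f≤g ∘ there))

∑-mono : ∀ (xs : List A) {f g : A → ℕ} → (∀ x → f x ≤ g x) → ∑ xs f ≤ ∑ xs g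
∑-mono xs f≤g = ∑-mono-∈ xs (λ {x} _ → f≤g x)

∑-const : ∀ (xs : List A) (n : ℕ) → ∑[ _ ← xs ] n ≡ length xs * n
∑-const []       n = refl
∑-const (x ∷ xs) n = cong (n +_) (∑-const xs n)

∑-one : ∀ (xs : List A) → ∑[ _ ← xs ] 1 ≡ length xs
∑-one xs = trans (∑-const xs 1) (*-identityʳ (length xs))

∑-++ : ∀ (xs ys : List A) (f : A → ℕ) → ∑ (xs ++ ys) f ≡ ∑ xs f + ∑ ys f
∑-++ []       ys f = refl
∑-++ (x ∷ xs) ys f = trans (cong (f x +_) (∑-++ xs ys f)) (sym (+-assoc (f x) _ _))

∑-map : ∀ (g : A → B) (xs : List A) (f : B → ℕ) → ∑ (map g xs) f ≡ ∑[ x ← xs ] f (g x)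
∑-map g []       f = refl
∑-map g (x ∷ xs) f = cong (f (g x) +_) (∑-map g xs f)

∑-concatMap : ∀ (g : A → List B) (xs : List A) (f : B → ℕ) →
              ∑ (concatMap g xs) f ≡ ∑[ x ← xs ] ∑ (g x) f
∑-concatMap g []       f = refl
∑-concatMap g (x ∷ xs) f =
  trans (∑-++ (g x) (concatMap g xs) f) (cong (∑ (g x) f +_) (∑-concatMap g xs f))

∑-cartesianProduct : ∀ (xs : List A) (ys : List B) (f : A × B → ℕ) →
                     ∑ (cartesianProduct xs ys) f ≡ ∑[ x ← xs ] ∑[ y ← ys ] f (x , y)
∑-cartesianProduct []       ys f = refl
∑-cartesianProduct (x ∷ xs) ys f =
  trans (∑-++ (map (x ,_) ys) _ f) (cong₂ _+_ (∑-map (x ,_) ys f) (∑-cartesianProduct xs ys f))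

∑-+ : ∀ (xs : List A) (f g : A → ℕ) → ∑[ x ← xs ] (f x + g x) ≡ ∑ xs f + ∑ xs g
∑-+ []       f g = refl
∑-+ (x ∷ xs) f g = trans (cong (f x + g x +_) (∑-+ xs f g)) (interchange (f x) (g x) _ _)

∑-swap : ∀ (xs : List A) (ys : List B) (f : A → B → ℕ) →
         ∑[ x ← xs ] ∑[ y ← ys ] f x y ≡ ∑[ y ← ys ] ∑[ x ← xs ] f x y
∑-swap []       ys f = sym (trans (∑-const ys 0) (*-zeroʳ (length ys)))
∑-swap (x ∷ xs) ys f =
  trans (cong (∑ ys (f x) +_) (∑-swap xs ys f)) (sym (∑-+ ys (f x) (λ y → ∑[ x ← xs ] f x y)))

length-cartesianProduct : ∀ (xs : List A) (ys : List B) →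
                          length (cartesianProduct xs ys) ≡ length xs * length ys
length-cartesianProduct xs ys = begin
  length (cartesianProduct xs ys)  ≡⟨ sym (∑-one (cartesianProduct xs ys)) ⟩
  ∑[ _ ← cartesianProduct xs ys ] 1 ≡⟨ ∑-cartesianProduct xs ys _ ⟩
  ∑[ _ ← xs ] ∑[ _ ← ys ] 1        ≡⟨ ∑-cong xs (λ _ → ∑-one ys) ⟩
  ∑[ _ ← xs ] length ys             ≡⟨ ∑-const xs _ ⟩
  length xs * length ys             ∎
  where open ≡-Reasoning

𝟙≤1 : {P : Set p} (d : Dec P) → 𝟙 d ≤ 1
𝟙≤1 (yes _) = s≤s z≤n
𝟙≤1 (no _)  = z≤n

𝟙+𝟙¬≡1 : {P : Set p} (d : Dec P) → 𝟙 d + 𝟙 (¬? d) ≡ 1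
𝟙+𝟙¬≡1 (yes _) = refl
𝟙+𝟙¬≡1 (no _)  = refl

length-filter≡count : {P : Pred A p} (P? : Decidable P) (xs : List A) → length (filter P? xs) ≡ count P? xs
length-filter≡count P? []       = refl
length-filter≡count P? (x ∷ xs) with P? x
... | yes _ = cong suc (length-filter≡count P? xs)
... | no  _ = length-filter≡count P? xs

count-filter : {P : Pred A p} {Q : Pred A q} (P? : Decidable P) (Q? : Decidable Q) (xs : List A) →
               count P? (filter Q? xs) ≡ count (P? ∩? Q?) xs
count-filter P? Q? []       = refl
count-filter P? Q? (x ∷ xs) with Q? x
... | yes _ rewrite Bool.∧-identityʳ (does (P? x)) = cong (𝟙 (P? x) +_) (count-filter P? Q? xs)
... | no  _ rewrite Bool.∧-zeroʳ (does (P? x))     = count-filter P? Q? xs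

count+count-∁≡length : {P : Pred A p} (P? : Decidable P) (xs : List A) → count P? xs + count (∁? P?) xs ≡ length xs
count+count-∁≡length P? xs =
  trans (sym (∑-+ xs _ _)) (trans (∑-cong xs (λ x → 𝟙+𝟙¬≡1 (P? x))) (∑-one xs))

Any⇒1≤count : {P : Pred A p} (P? : Decidable P) {xs : List A} → Any P xs → 1 ≤ count P? xs
Any⇒1≤count P? {x ∷ xs} (here px) with P? x
... | yes _   = s≤s z≤n
... | no ¬px  = ⊥-elim (¬px px)
Any⇒1≤count P? {x ∷ xs} (there pxs) = ≤-trans (Any⇒1≤count P? pxs) (m≤n+m _ (𝟙 (P? x)))

¬Any⇒count≡0 : {P : Pred A p} (P? : Decidable P) (xs : List A) → ¬ Any P xs → count P? xs ≡ 0
¬Any⇒count≡0 P? []       ¬any = refl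
¬Any⇒count≡0 P? (x ∷ xs) ¬any with P? x
... | yes px = ⊥-elim (¬any (here px))
... | no  _  = ¬Any⇒count≡0 P? xs (¬any ∘ there)

count≤1⇒count≤𝟙any : {P : Pred A p} (P? : Decidable P) (xs : List A) →
                     count P? xs ≤ 1 → count P? xs ≤ 𝟙 (Any.any? P? xs)
count≤1⇒count≤𝟙any P? xs count≤1 with Any.any? P? xs
... | yes _   = count≤1
... | no ¬any = ≤-reflexive (¬Any⇒count≡0 P? xs ¬any)

-- Lists without repeated entries

AtMostOnce : (p : Level) → Rel A ℓ → List A → Set _
AtMostOnce {A = A} p _≈_ xs =
  ∀ {P : Pred A p} (P? : Decidable P) → (∀ {x y} → P x → P y → x ≈ y) → count P? xs ≤ 1

Unique⇒AtMostOnce : {xs : List A} → Unique xs → AtMostOnce p _≡_ xs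
Unique⇒AtMostOnce {xs = []}     []                     P? P-unique = z≤n
Unique⇒AtMostOnce {xs = x ∷ xs} (x∉xs ∷ xs-unique) P? P-unique with P? x
... | yes px = s≤s (≤-reflexive (¬Any⇒count≡0 P? xs λ pxs →
                 let x≢y , py = All.lookupAny x∉xs pxs in x≢y (P-unique px py)))
... | no _   = Unique⇒AtMostOnce xs-unique P? P-unique

map-AtMostOnce : {_≈_ : Rel B ℓ} {f : A → B} {xs : List A} →
                 (∀ {x y} → f x ≈ f y → x ≡ y) → AtMostOnce p _≡_ xs → AtMostOnce p _≈_ (map f xs)
map-AtMostOnce {f = f} {xs} f-injective xs-once P? P-unique =
  subst (_≤ 1) (sym (∑-map f xs (𝟙 ∘ P?))) (xs-once (P? ∘ f) (λ px py → f-injective (P-unique px py)))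

∑-allVecs : ∀ m (xs : List A) (f : Vec A (suc m) → ℕ) →
            ∑ (allVecs (suc m) xs) f ≡ ∑[ x ← xs ] ∑[ t ← allVecs m xs ] f (x ∷ t)
∑-allVecs m xs f = trans (∑-concatMap _ xs f) (∑-cong xs (λ x → ∑-map (x ∷_) (allVecs m xs) f))

length-allVecs : ∀ m (xs : List A) → length (allVecs m xs) ≡ length xs ^ m
length-allVecs zero    xs = refl
length-allVecs (suc m) xs = begin
  length (allVecs (suc m) xs)           ≡⟨ sym (∑-one (allVecs (suc m) xs)) ⟩
  ∑[ _ ← allVecs (suc m) xs ] 1         ≡⟨ ∑-allVecs m xs _ ⟩
  ∑[ _ ← xs ] ∑[ _ ← allVecs m xs ] 1   ≡⟨ ∑-cong xs (λ _ → trans (∑-one (allVecs m xs)) (length-allVecs m xs)) ⟩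
  ∑[ _ ← xs ] length xs ^ m             ≡⟨ ∑-const xs _ ⟩
  length xs * length xs ^ m             ∎
  where open ≡-Reasoning

∈-allVecs : {xs : List A} → (∀ x → x ∈ˡ xs) → ∀ {m} (v : Vec A m) → v ∈ˡ allVecs m xs
∈-allVecs all∈ []                  = here refl
∈-allVecs {xs = xs} all∈ {suc m} (x ∷ v) =
  ∈-concat⁺′ (∈-map⁺ (x ∷_) (∈-allVecs all∈ v)) (∈-map⁺ (λ y → map (y ∷_) (allVecs m xs)) (all∈ x))

allVecs-AtMostOnce : {A : Set a} {_≈_ : Rel A ℓ} {xs : List A} →
                     AtMostOnce (a ⊔ p) _≈_ xs → ∀ m → AtMostOnce (a ⊔ p) (Pointwise _≈_) (allVecs m xs)
allVecs-AtMostOnce xs-once zero    P? P-unique = ≤-trans (≤-reflexive (+-identityʳ _)) (𝟙≤1 (P? []))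
allVecs-AtMostOnce {p = p} {_≈_ = _≈_} {xs} xs-once (suc m) {P} P? P-unique = begin
  count P? (allVecs (suc m) xs)             ≡⟨ ∑-allVecs m xs _ ⟩
  ∑[ x ← xs ] count (λ t → P? (x ∷ t)) rows ≤⟨ ∑-mono xs tails-once ⟩
  count extends? xs                         ≤⟨ xs-once extends? heads-unique ⟩
  1                                         ∎
  where
  open ≤-Reasoning
  rows = allVecs m xs
  extends? : Decidable (λ x → Any (λ t → P (x ∷ t)) rows)
  extends? x = Any.any? (λ t → P? (x ∷ t)) rows
  tails-once : ∀ x → count (λ t → P? (x ∷ t)) rows ≤ 𝟙 (extends? x)
  tails-once x = count≤1⇒count≤𝟙any (λ t → P? (x ∷ t)) rows
    (allVecs-AtMostOnce {p = p} xs-once m (λ t → P? (x ∷ t)) (λ pt pt′ → Pointwise.tail (P-unique pt pt′)))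
  heads-unique : ∀ {x y} → Any (λ t → P (x ∷ t)) rows → Any (λ t → P (y ∷ t)) rows → x ≈ y
  heads-unique px py = Pointwise.head (P-unique (proj₂ (satisfied px)) (proj₂ (satisfied py)))

count-allVecs-determinedAt :
  {_≈_ : Rel A ℓ} {xs : List A} → AtMostOnce p _≈_ xs →
  ∀ m (j : Fin (suc m)) {P : Pred (Vec A (suc m)) p} (P? : Decidable P) →
  (∀ v {x y} → P (insertAt v j x) → P (insertAt v j y) → x ≈ y) →
  count P? (allVecs (suc m) xs) ≤ length xs ^ m
count-allVecs-determinedAt {xs = xs} xs-once m zero P? P-determined = begin
  count P? (allVecs (suc m) xs)                          ≡⟨ ∑-allVecs m xs _ ⟩
  ∑[ x ← xs ] ∑[ t ← allVecs m xs ] 𝟙 (P? (x ∷ t))       ≡⟨ ∑-swap xs (allVecs m xs) _ ⟩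
  ∑[ t ← allVecs m xs ] count (λ x → P? (x ∷ t)) xs      ≤⟨ ∑-mono (allVecs m xs) column-once ⟩
  ∑[ _ ← allVecs m xs ] 1                                ≡⟨ ∑-one (allVecs m xs) ⟩
  length (allVecs m xs)                                  ≡⟨ length-allVecs m xs ⟩
  length xs ^ m                                          ∎
  where
  open ≤-Reasoning
  column-once : ∀ t → count (λ x → P? (x ∷ t)) xs ≤ 1
  column-once t = xs-once (λ x → P? (x ∷ t)) (P-determined t)
count-allVecs-determinedAt {xs = xs} xs-once (suc m) (suc j) P? P-determined = begin
  count P? (allVecs (suc (suc m)) xs)                         ≡⟨ ∑-allVecs (suc m) xs _ ⟩
  ∑[ x ← xs ] count (λ t → P? (x ∷ t)) (allVecs (suc m) xs)   ≤⟨ ∑-mono xs row-bound ⟩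
  ∑[ _ ← xs ] length xs ^ m                                   ≡⟨ ∑-const xs _ ⟩
  length xs ^ suc m                                           ∎
  where
  open ≤-Reasoning
  row-bound : ∀ x → count (λ t → P? (x ∷ t)) (allVecs (suc m) xs) ≤ length xs ^ m
  row-bound x =
    count-allVecs-determinedAt {xs = xs} xs-once m j (λ t → P? (x ∷ t)) (λ v → P-determined (x ∷ v))

-- Half-size subsets

bools : List Bool
bools = true ∷ false ∷ []

∈-bools : ∀ b → b ∈ˡ bools
∈-bools true  = here refl
∈-bools false = there (here refl)

boolVecs-AtMostOnce : ∀ m → AtMostOnce p _≡_ (allVecs m bools)
boolVecs-AtMostOnce {p = p} m P? P-unique =
  allVecs-AtMostOnce {p = p} (Unique⇒AtMostOnce bools-unique) m P? (λ px py → ≡⇒Pointwise-≡ (P-unique px py))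
  where
  bools-unique : Unique bools
  bools-unique = ((λ ()) ∷ []) ∷ [] ∷ []

count-size≡C : ∀ m k → count (λ S → ∣ S ∣ ℕ.≟ k) (allVecs m bools) ≡ m C k
count-size≡C zero    zero    = refl
count-size≡C zero    (suc k) = refl
count-size≡C (suc m) zero    = begin
  count (λ S → ∣ S ∣ ℕ.≟ 0) (allVecs (suc m) bools)               ≡⟨ ∑-allVecs m bools _ ⟩
  (∑[ _ ← allVecs m bools ] 0) + (count (λ S → ∣ S ∣ ℕ.≟ 0) (allVecs m bools) + 0)
    ≡⟨ cong₂ _+_ (trans (∑-const (allVecs m bools) 0) (*-zeroʳ (length (allVecs m bools)))) (+-identityʳ _) ⟩
  count (λ S → ∣ S ∣ ℕ.≟ 0) (allVecs m bools)                     ≡⟨ count-size≡C m zero ⟩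
  1                                                              ∎
  where open ≡-Reasoning
count-size≡C (suc m) (suc k) = begin
  count (λ S → ∣ S ∣ ℕ.≟ suc k) (allVecs (suc m) bools)          ≡⟨ ∑-allVecs m bools _ ⟩
  count (λ S → ∣ S ∣ ℕ.≟ k) (allVecs m bools) + (count (λ S → ∣ S ∣ ℕ.≟ suc k) (allVecs m bools) + 0)
    ≡⟨ cong₂ _+_ (count-size≡C m k) (trans (+-identityʳ _) (count-size≡C m (suc k))) ⟩
  m C k + m C suc k                                              ≡⟨ nCk+nC[k+1]≡[n+1]C[k+1] m k ⟩
  suc m C suc k                                                  ∎
  where open ≡-Reasoning

∃∈∖-∷ : ∀ {n} {p q : Subset n} {s t} → ∃ (λ x → x ∈ p × x ∉ q) → ∃ λ x → x ∈ s ∷ p × x ∉ t ∷ q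
∃∈∖-∷ (x , x∈p , x∉q) = suc x , there x∈p , x∉q ∘ drop-there

∣q∣≤∣p∣∧p≢q⇒∃∈∖ : ∀ {n} (p q : Subset n) → ∣ q ∣ ≤ ∣ p ∣ → p ≢ q → ∃ λ x → x ∈ p × x ∉ q
∣q∣≤∣p∣∧p≢q⇒∃∈∖ []            []            _         p≢q = ⊥-elim (p≢q refl)
∣q∣≤∣p∣∧p≢q⇒∃∈∖ (inside ∷ p)  (outside ∷ q) _         _   = zero , here , λ ()
∣q∣≤∣p∣∧p≢q⇒∃∈∖ (inside ∷ p)  (inside ∷ q)  (s≤s q≤p) p≢q =
  ∃∈∖-∷ (∣q∣≤∣p∣∧p≢q⇒∃∈∖ p q q≤p (p≢q ∘ cong (inside ∷_)))
∣q∣≤∣p∣∧p≢q⇒∃∈∖ (outside ∷ p) (outside ∷ q) q≤p       p≢q =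
  ∃∈∖-∷ (∣q∣≤∣p∣∧p≢q⇒∃∈∖ p q q≤p (p≢q ∘ cong (outside ∷_)))
∣q∣≤∣p∣∧p≢q⇒∃∈∖ (outside ∷ p) (inside ∷ q)  q<p       _   =
  ∃∈∖-∷ (∣q∣≤∣p∣∧p≢q⇒∃∈∖ p q (<⇒≤ q<p) (λ p≡q → <-irrefl (cong ∣_∣ (sym p≡q)) q<p))

_≟ˢ_ : ∀ {n} → (p q : Subset n) → Dec (p ≡ q)
_≟ˢ_ = Vec.≡-dec Bool._≟_

length-halfSubsets : ∀ m → length (halfSubsets m) ≡ m C (m / 2)
length-halfSubsets m = trans (length-filter≡count _ (allVecs m bools)) (count-size≡C m (m / 2))

length-halfSubsets≤ : ∀ m → length (halfSubsets m) ≤ 2 ^ m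
length-halfSubsets≤ m =
  ≤-trans (List.length-filter (λ S → ∣ S ∣ ℕ.≟ m / 2) (allVecs m bools)) (≤-reflexive (length-allVecs m bools))

∈-halfSubsets⁺ : ∀ {m} {S : Subset m} → ∣ S ∣ ≡ m / 2 → S ∈ˡ halfSubsets m
∈-halfSubsets⁺ {S = S} ∣S∣≡ = ∈-filter⁺ (λ S → ∣ S ∣ ℕ.≟ _) (∈-allVecs ∈-bools S) ∣S∣≡

∈-halfSubsets⁻ : ∀ {m} {S : Subset m} → S ∈ˡ halfSubsets m → ∣ S ∣ ≡ m / 2
∈-halfSubsets⁻ {m} S∈ = proj₂ (∈-filter⁻ (λ S → ∣ S ∣ ℕ.≟ m / 2) {xs = allVecs m bools} S∈)

signedSubsetPairs : ∀ m → List (Vec Bool m × Subset m × Subset m)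
signedSubsetPairs m = cartesianProduct (allSigns m) (cartesianProduct (halfSubsets m) (halfSubsets m))

distinctSubsets? : ∀ {m} → Decidable {A = Vec Bool m × Subset m × Subset m} (λ (_ , S , S′) → S ≢ S′)
distinctSubsets? (_ , S , S′) = ¬? (S ≟ˢ S′)

collisionCandidates : ∀ m → List (Vec Bool m × Subset m × Subset m)
collisionCandidates m = filter distinctSubsets? (signedSubsetPairs m)

length-collisionCandidates≤ : ∀ m → length (collisionCandidates m) ≤ 2 ^ m * (2 ^ m * 2 ^ m)
length-collisionCandidates≤ m = begin
  length (collisionCandidates m)          ≤⟨ List.length-filter distinctSubsets? (signedSubsetPairs m) ⟩
  length (signedSubsetPairs m)            ≡⟨ trans (length-cartesianProduct (allSigns m) _)
                                                   (cong (length (allSigns m) *_) (length-cartesianProduct (halfSubsets m) _)) ⟩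
  length (allSigns m) * (length (halfSubsets m) * length (halfSubsets m))
    ≤⟨ *-mono-≤ (≤-reflexive (length-allVecs m bools)) (*-mono-≤ (length-halfSubsets≤ m) (length-halfSubsets≤ m)) ⟩
  2 ^ m * (2 ^ m * 2 ^ m)                 ∎
  where open ≤-Reasoning

∈-collisionCandidates⁺ : ∀ {m} σ {S S′ : Subset m} → ∣ S ∣ ≡ m / 2 → ∣ S′ ∣ ≡ m / 2 → S ≢ S′ →
                         (σ , S , S′) ∈ˡ collisionCandidates m
∈-collisionCandidates⁺ σ ∣S∣≡ ∣S′∣≡ S≢S′ = ∈-filter⁺ distinctSubsets?
  (∈-cartesianProduct⁺ (∈-allVecs ∈-bools σ) (∈-cartesianProduct⁺ (∈-halfSubsets⁺ ∣S∣≡) (∈-halfSubsets⁺ ∣S′∣≡))) S≢S′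

∈-collisionCandidates⁻ : ∀ {m σ} {S S′ : Subset m} → (σ , S , S′) ∈ˡ collisionCandidates m → ∃ λ j → j ∈ S × j ∉ S′
∈-collisionCandidates⁻ {m} {S = S} {S′} t∈
  with t∈pairs , S≢S′ ← ∈-filter⁻ distinctSubsets? {xs = signedSubsetPairs m} t∈
  with S∈ , S′∈ ← ∈-cartesianProduct⁻ (halfSubsets m) (halfSubsets m)
                    (proj₂ (∈-cartesianProduct⁻ (allSigns m) _ t∈pairs))
  = ∣q∣≤∣p∣∧p≢q⇒∃∈∖ S S′ (≤-reflexive (trans (∈-halfSubsets⁻ S′∈) (sym (∈-halfSubsets⁻ S∈)))) S≢S′

-- Collisions of the last query

module _ {c ℓ} (G : Group c ℓ) (FG : IsFiniteGroup G) where
  open Group G using (Carrier; _≈_; ε) renaming (trans to ≈-trans; sym to ≈-sym; reflexive to ≈-reflexive)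
  open IsFiniteGroup FG using (card; enum; enum-inj; _≈?_; elements)
  open URST G FG
  open GroupProperties G using (∙-cancelˡ; ∙-cancelʳ; ⁻¹-injective)

  sumFrom-injective : ∀ {m} (X : Vec Carrier m) σ S {a b} → sumFrom a X σ S ≈ sumFrom b X σ S → a ≈ b
  sumFrom-injective []      []      []            eq = eq
  sumFrom-injective (x ∷ X) (s ∷ σ) (inside ∷ S)  eq = ∙-cancelʳ _ _ _ (sumFrom-injective X σ S eq)
  sumFrom-injective (x ∷ X) (s ∷ σ) (outside ∷ S) eq = sumFrom-injective X σ S eq

  sumFrom-insertAt-∉ : ∀ {m} acc (v : Vec Carrier m) j σ S → j ∉ S →
                       ∀ x y → sumFrom acc (insertAt v j x) σ S ≡ sumFrom acc (insertAt v j y) σ S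
  sumFrom-insertAt-∉ acc v       zero    (s ∷ σ) (outside ∷ S) _   x y = refl
  sumFrom-insertAt-∉ acc v       zero    (s ∷ σ) (inside ∷ S)  j∉S x y = ⊥-elim (j∉S here)
  sumFrom-insertAt-∉ acc (a ∷ v) (suc j) (s ∷ σ) (b ∷ S)       j∉S x y =
    sumFrom-insertAt-∉ _ v j σ S (j∉S ∘ there) x y

  sumFrom-insertAt-∈ : ∀ {m} acc (v : Vec Carrier m) j σ S → j ∈ S →
                       ∀ {x y} → sumFrom acc (insertAt v j x) σ S ≈ sumFrom acc (insertAt v j y) σ S → x ≈ y
  sumFrom-insertAt-∈ acc v       zero    (true ∷ σ)  (inside ∷ S) here eq =
    ∙-cancelˡ acc _ _ (sumFrom-injective v σ S eq)
  sumFrom-insertAt-∈ acc v       zero    (false ∷ σ) (inside ∷ S) here eq =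
    ⁻¹-injective (∙-cancelˡ acc _ _ (sumFrom-injective v σ S eq))
  sumFrom-insertAt-∈ acc (a ∷ v) (suc j) (s ∷ σ)     (b ∷ S)      (there j∈S) eq =
    sumFrom-insertAt-∈ _ v j σ S j∈S eq

  Collides : ∀ {m} → Vec Carrier m → Vec Bool m × Subset m × Subset m → Set ℓ
  Collides X (σ , S , S′) = lastQuery X σ S ≈ lastQuery X σ S′

  collides? : ∀ {m} (X : Vec Carrier m) t → Dec (Collides X t)
  collides? X (σ , S , S′) = lastQuery X σ S ≈? lastQuery X σ S′

  collision-determinedAt : ∀ {m} σ (S S′ : Subset (suc m)) {j} → j ∈ S → j ∉ S′ →
                           ∀ v {x y} → Collides (insertAt v j x) (σ , S , S′) → Collides (insertAt v j y) (σ , S , S′) → x ≈ y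
  collision-determinedAt σ S S′ {j} j∈S j∉S′ v {x} {y} collides-x collides-y =
    sumFrom-insertAt-∈ ε v j σ S j∈S
      (≈-trans collides-x (≈-trans (≈-reflexive (sumFrom-insertAt-∉ ε v j σ S′ j∉S′ x y)) (≈-sym collides-y)))

  elements-AtMostOnce : AtMostOnce p _≈_ elements
  elements-AtMostOnce = map-AtMostOnce {xs = allFin card} (λ {i} {j} → enum-inj i j) (Unique⇒AtMostOnce (allFin⁺ card))

  length-elements : length elements ≡ card
  length-elements = trans (length-map enum (allFin card)) (length-tabulate (λ i → i))

  numX≡card^m : ∀ m → numX m ≡ card ^ m
  numX≡card^m m = trans (length-allVecs m elements) (cong (_^ m) length-elements)

  length-randomness : ∀ m → length (randomness m) ≡ 2 ^ m * (m C (m / 2))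
  length-randomness m = trans (length-cartesianProduct (allSigns m) (halfSubsets m))
                              (cong₂ _*_ (length-allVecs m bools) (length-halfSubsets m))

  CollisionFree : ∀ {m} → Vec Carrier m → Set ℓ
  CollisionFree {m} X = All (¬_ ∘ Collides X) (collisionCandidates m)

  hits≤2^m : ∀ {m} (X : Vec Carrier m) → CollisionFree X → ∀ z → hits X z ≤ 2 ^ m
  hits≤2^m {m} X collisionFree z = begin
    hits X z                                                  ≡⟨ length-filter≡count hit? (randomness m) ⟩
    count hit? (randomness m)                                 ≡⟨ ∑-cartesianProduct (allSigns m) (halfSubsets m) _ ⟩
    ∑[ σ ← allSigns m ] count (hit? ∘ (σ ,_)) (halfSubsets m) ≤⟨ ∑-mono (allSigns m) at-most-one-hit ⟩
    ∑[ _ ← allSigns m ] 1                                     ≡⟨ ∑-one (allSigns m) ⟩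
    length (allSigns m)                                       ≡⟨ length-allVecs m bools ⟩
    2 ^ m                                                     ∎
    where
    open ≤-Reasoning
    hit? : ∀ (t : Vec Bool m × Subset m) → Dec (lastQuery X (proj₁ t) (proj₂ t) ≈ z)
    hit? t = lastQuery X (proj₁ t) (proj₂ t) ≈? z
    size? : ∀ (S : Subset m) → Dec (∣ S ∣ ≡ m / 2)
    size? S = ∣ S ∣ ℕ.≟ m / 2
    hit-unique : ∀ σ {S S′} → lastQuery X σ S ≈ z × ∣ S ∣ ≡ m / 2 → lastQuery X σ S′ ≈ z × ∣ S′ ∣ ≡ m / 2 → S ≡ S′
    hit-unique σ {S} {S′} (y≈z , ∣S∣≡) (y′≈z , ∣S′∣≡) with S ≟ˢ S′
    ... | yes S≡S′ = S≡S′
    ... | no S≢S′  = ⊥-elim (All.lookup collisionFree (∈-collisionCandidates⁺ σ ∣S∣≡ ∣S′∣≡ S≢S′) (≈-trans y≈z (≈-sym y′≈z)))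
    at-most-one-hit : ∀ σ → count (hit? ∘ (σ ,_)) (halfSubsets m) ≤ 1
    at-most-one-hit σ = subst (_≤ 1) (sym (count-filter (hit? ∘ (σ ,_)) size? (allVecs m bools)))
                          (boolVecs-AtMostOnce m ((hit? ∘ (σ ,_)) ∩? size?) (hit-unique σ))

  CollisionFree⇒FlatDX : ∀ {m} (X : Vec Carrier m) → CollisionFree X → FlatDX X
  CollisionFree⇒FlatDX {m} X collisionFree = All.tabulate λ {z} _ → begin
    hits X z * (m C (m / 2))  ≤⟨ *-monoˡ-≤ (m C (m / 2)) (hits≤2^m X collisionFree z) ⟩
    2 ^ m * (m C (m / 2))     ≡⟨ sym (length-randomness m) ⟩
    length (randomness m)   ∎
    where open ≤-Reasoning

  ¬FlatDX⇒collision : ∀ {m} (X : Vec Carrier m) → ¬ FlatDX X → Any (Collides X) (collisionCandidates m)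
  ¬FlatDX⇒collision {m} X ¬flat with Any.any? (collides? X) (collisionCandidates m)
  ... | yes collision = collision
  ... | no ¬collision = ⊥-elim (¬flat (CollisionFree⇒FlatDX X (¬Any⇒All¬ _ ¬collision)))

  numBadX : ℕ → ℕ
  numBadX m = count (∁? flatDX?) (allX m)

  numX≡numGoodX+numBadX : ∀ m → numX m ≡ numGoodX m + numBadX m
  numX≡numGoodX+numBadX m =
    sym (trans (cong (_+ numBadX m) (length-filter≡count flatDX? (allX m))) (count+count-∁≡length flatDX? (allX m)))

  count-collisions≤ : ∀ m {t} → t ∈ˡ collisionCandidates (suc m) → count (λ X → collides? X t) (allX (suc m)) ≤ card ^ m
  count-collisions≤ m {σ , S , S′} t∈ with j , j∈S , j∉S′ ← ∈-collisionCandidates⁻ t∈ =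
    subst (count (λ X → collides? X (σ , S , S′)) (allX (suc m)) ≤_) (cong (_^ m) length-elements)
      (count-allVecs-determinedAt {xs = elements} elements-AtMostOnce m j (λ X → collides? X (σ , S , S′))
        (collision-determinedAt σ S S′ j∈S j∉S′))

  numBadX≤ : ∀ m → numBadX (suc m) ≤ length (collisionCandidates (suc m)) * card ^ m
  numBadX≤ m = begin
    numBadX (suc m)                                           ≤⟨ ∑-mono (allX (suc m)) bad≤collisions ⟩
    ∑[ X ← allX (suc m) ] count (collides? X) candidates      ≡⟨ ∑-swap (allX (suc m)) candidates _ ⟩
    ∑[ t ← candidates ] count (λ X → collides? X t) (allX (suc m))
                                                              ≤⟨ ∑-mono-∈ candidates (count-collisions≤ m) ⟩
    ∑[ _ ← candidates ] card ^ m                              ≡⟨ ∑-const candidates (card ^ m) ⟩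
    length candidates * card ^ m                              ∎
    where
    open ≤-Reasoning
    candidates = collisionCandidates (suc m)
    bad≤collisions : ∀ X → 𝟙 (∁? flatDX? X) ≤ count (collides? X) candidates
    bad≤collisions X with flatDX? X
    ... | yes _     = z≤n
    ... | no ¬flat = Any⇒1≤count (collides? X) (¬FlatDX⇒collision X ¬flat)

  numBadX*2^m≤numX : ∀ m → (2 ^ suc m) ^ 4 ≤ card → numBadX (suc m) * 2 ^ suc m ≤ numX (suc m)
  numBadX*2^m≤numX m 2^4m≤card = begin
    numBadX (suc m) * 2ᵐ                ≤⟨ *-monoˡ-≤ 2ᵐ (≤-trans (numBadX≤ m) (*-monoˡ-≤ (card ^ m) candidates≤)) ⟩
    2ᵐ * (2ᵐ * 2ᵐ) * card ^ m * 2ᵐ      ≡⟨ rearrange 2ᵐ (card ^ m) ⟩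
    2ᵐ ^ 4 * card ^ m                   ≤⟨ *-monoˡ-≤ (card ^ m) 2^4m≤card ⟩
    card * card ^ m                     ≡⟨ sym (numX≡card^m (suc m)) ⟩
    numX (suc m)                        ∎
    where
    open ≤-Reasoning
    2ᵐ = 2 ^ suc m
    candidates≤ = length-collisionCandidates≤ (suc m)
    -- x ^ 4 unfolded, so that solve-∀ accepts the identity.
    rearrange : ∀ x y → x * (x * x) * y * x ≡ x * (x * (x * (x * 1))) * y
    rearrange = solve-∀

lemma5p2 : ∀ {c₁ ℓ₁ c₂ ℓ₂ : Level}
    (G : Group c₁ ℓ₁) (FG : IsFiniteGroup G)
    (H : Group c₂ ℓ₂) (FH : IsFiniteGroup H)
    (f : Group.Carrier G → Group.Carrier H)
    (m : ℕ) → 2 ∣ m → (2 ^ m) ^ 4 ≤ IsFiniteGroup.card FG →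
    URST.numX G FG m * 2 ^ m ≤ URST.numGoodX G FG m * 2 ^ m + URST.numX G FG m
lemma5p2 G FG H FH f zero    _ _ = ≤-trans (≤-reflexive (*-identityʳ _)) (m≤n+m _ _)
lemma5p2 G FG H FH f (suc m) _ 2^4m≤card = begin
  numX (suc m) * 2 ^ suc m                                   ≡⟨ cong (_* 2 ^ suc m) (numX≡numGoodX+numBadX G FG (suc m)) ⟩
  (numGoodX (suc m) + numBadX G FG (suc m)) * 2 ^ suc m      ≡⟨ *-distribʳ-+ (2 ^ suc m) (numGoodX (suc m)) _ ⟩
  numGoodX (suc m) * 2 ^ suc m + numBadX G FG (suc m) * 2 ^ suc m
                                                             ≤⟨ +-monoʳ-≤ _ (numBadX*2^m≤numX G FG m 2^4m≤card) ⟩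
  numGoodX (suc m) * 2 ^ suc m + numX (suc m)                ∎
  where
  open ≤-Reasoning
  open URST G FG using (numX; numGoodX)
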